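{- Let $G=(X,Y;E)$ be an $(a,b)$-biregular bipartite graph (without multiple edges), where every vertex of $X$ has degree $a$ and every vertex of $Y$ has degree $b$. Then there is a decomposition of $G$ into at most $b$ subgraphs $F_1,\dots,F_b$ (i.e. edge-disjoint subgraphs whose edge sets together cover $E$) such that $\Delta(F_i)=a$ for each $i$ and every vertex of $X$ is in precisely one of the subgraphs $F_1,\dots,F_b$.
   Context: $G=(X,Y;E)$ denotes a bipartite graph with parts $X$ and $Y$ and edge set $E$. A bipartite graph is $(a,b)$-biregular if all vertices of $X$ have degree $a$ and all vertices of $Y$ have degree $b$. $\Delta(F)$ denotes the maximum degree of $F$. -}

module Defs where

open import Data.Nat using (ℕ; zero; suc; _+_; _⊔_)
open import Data.Fin using (Fin; zero; suc)
open import Data.Bool using (Bool; true; false; if_then_else_)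
open import Data.Product using (_×_)
open import Relation.Binary.PropositionalEquality using (_≡_)

count : ∀ {n} → (Fin n → Bool) → ℕ
count {zero}  p = 0
count {suc n} p = (if p zero then 1 else 0) + count (λ i → p (suc i))

maxOver : ∀ {n} → (Fin n → ℕ) → ℕ
maxOver {zero}  f = 0
maxOver {suc n} f = f zero ⊔ maxOver (λ i → f (suc i))

-- A simple bipartite graph G = (X, Y; E) with X = Fin m, Y = Fin n,
-- edge relation E x y ≡ true iff xy is an edge (no multiple edges).
BipGraph : ℕ → ℕ → Set
BipGraph m n = Fin m → Fin n → Bool

degX : ∀ {m n} → BipGraph m n → Fin m → ℕ
degX E x = count (λ y → E x y)

degY : ∀ {m n} → BipGraph m n → Fin n → ℕ
degY E y = count (λ x → E x y)

Biregular : ∀ {m n} → BipGraph m n → ℕ → ℕ → Set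
Biregular {m} {n} E a b = (∀ (x : Fin m) → degX E x ≡ a) × (∀ (y : Fin n) → degY E y ≡ b)

record Subgraph {m n : ℕ} (E : BipGraph m n) : Set where
  field
    inX  : Fin m → Bool
    inY  : Fin n → Bool
    edge : Fin m → Fin n → Bool
    edge⊆E : ∀ x y → edge x y ≡ true → E x y ≡ true
    edge⊆V : ∀ x y → edge x y ≡ true → (inX x ≡ true) × (inY y ≡ true)

open Subgraph public

-- Δ(F): maximum degree of F (degrees are taken inside F; vertices not
-- in F have F-degree 0 since F's edges only use F's vertices)
Δ : ∀ {m n} {E : BipGraph m n} → Subgraph E → ℕ
Δ F = maxOver (degX (edge F)) ⊔ maxOver (degY (edge F))

-- Colour the vertices of X greedily with b colours so that no vertex of Y
-- has more than a neighbours of any one colour.  A new vertex x always finds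
-- a free colour: were every colour i blocked at some neighbour y_i of x,
-- double counting the coloured neighbours of the neighbours of x would give
--   b·a ≤ Σ_{y ∼ x} (deg y − 1) ≤ a·(b − 1).
-- The subgraph F_i consists of the vertices of colour i with all their edges
-- (and all of Y); the unused colours are discarded.
module Submission where

open import Defs
open import Data.Bool using (Bool; true; false; if_then_else_; _∧_)
open import Data.Empty using (⊥-elim)
open import Data.Fin using (Fin; zero; suc; punchIn; punchOut)
open import Data.Fin.Properties using (_≟_; any?; all?; ¬∀⟶∃¬; punchIn-injective; punchIn-punchOut)
open import Data.Nat using (ℕ; zero; suc; _+_; _*_; _≤_; _<_; z≤n; _<?_)
open import Data.Nat.Properties hiding (_≟_)
open import Data.Product using (Σ; ∃; _×_; _,_; proj₁; proj₂)
open import Data.Vec.Functional using (_∷_)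
open import Function using (id; _∘_; mk⇔)
open import Relation.Nullary using (yes; no; does)
open import Relation.Nullary.Decidable using (dec-true; does-⇔)
open import Relation.Binary.PropositionalEquality
open import Algebra.Properties.Semiring.Sum +-*-semiring
  using (sum; sum-syntax; sum-cong-≗; ∑-comm; ∑-distrib-+; *-distribˡ-sum; *-distribʳ-sum)

⟦_⟧ : Bool → ℕ
⟦ b ⟧ = if b then 1 else 0

∧-≡-true : ∀ b {e} → b ∧ e ≡ true → b ≡ true × e ≡ true
∧-≡-true true e≡true = refl , e≡true

≟-true⇒≡ : ∀ {k} {i j : Fin k} → does (i ≟ j) ≡ true → i ≡ j
≟-true⇒≡ {i = i} {j} h with i ≟ j
... | yes i≡j = i≡j

≟-refl : ∀ {k} (i : Fin k) → does (i ≟ i) ≡ true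
≟-refl i = dec-true (i ≟ i) refl

⟦⟧*-monoʳ-≤ : ∀ p {x y} → (p ≡ true → x ≤ y) → ⟦ p ⟧ * x ≤ ⟦ p ⟧ * y
⟦⟧*-monoʳ-≤ true  x≤y = *-monoʳ-≤ 1 (x≤y refl)
⟦⟧*-monoʳ-≤ false _   = z≤n

∑-mono-≤ : ∀ {n} {f g : Fin n → ℕ} → (∀ i → f i ≤ g i) → sum f ≤ sum g
∑-mono-≤ {zero}  f≤g = z≤n
∑-mono-≤ {suc n} f≤g = +-mono-≤ (f≤g zero) (∑-mono-≤ (f≤g ∘ suc))

∑-const : ∀ n k → ∑[ i < n ] k ≡ n * k
∑-const zero    k = refl
∑-const (suc n) k = cong (k +_) (∑-const n k)

term≤∑ : ∀ {n} (f : Fin n → ℕ) i → f i ≤ sum f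
term≤∑ f zero    = m≤m+n (f zero) _
term≤∑ f (suc i) = ≤-trans (term≤∑ (f ∘ suc) i) (m≤n+m _ (f zero))

*≤∑∑-witnessed : ∀ {k n a} (f : Fin k → Fin n → ℕ) → (∀ i → ∃ λ j → a ≤ f i j) →
  k * a ≤ ∑[ i < k ] ∑[ j < n ] f i j
*≤∑∑-witnessed {k} {a = a} f witness = subst (_≤ _) (∑-const k a)
  (∑-mono-≤ λ i → ≤-trans (proj₂ (witness i)) (term≤∑ (f i) (proj₁ (witness i))))

count-as-sum : ∀ {n} (p : Fin n → Bool) → count p ≡ ∑[ i < n ] ⟦ p i ⟧
count-as-sum {zero}  p = refl
count-as-sum {suc n} p = cong (⟦ p zero ⟧ +_) (count-as-sum (p ∘ suc))

count-cong : ∀ {n} {p q : Fin n → Bool} → (∀ i → p i ≡ q i) → count p ≡ count q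
count-cong {p = p} {q} p≗q = begin
  count p              ≡⟨ count-as-sum p ⟩
  ∑[ i < _ ] ⟦ p i ⟧   ≡⟨ sum-cong-≗ (cong ⟦_⟧ ∘ p≗q) ⟩
  ∑[ i < _ ] ⟦ q i ⟧   ≡⟨ count-as-sum q ⟨
  count q              ∎
  where open ≡-Reasoning

count-false : ∀ {n} → count {n} (λ _ → false) ≡ 0
count-false {zero}  = refl
count-false {suc n} = count-false {n}

-- Colour classes are tested with does rather than ⌊_⌋ because does (suc j ≟ suc i)
-- reduces to does (j ≟ i), which the recursion below relies on.
count-fibre : ∀ {k} (j : Fin k) b → count (λ i → does (j ≟ i) ∧ b) ≡ ⟦ b ⟧
count-fibre {suc k} zero b = trans (cong (⟦ b ⟧ +_) (count-false {k})) (+-identityʳ ⟦ b ⟧)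
count-fibre (suc j) b = count-fibre j b

count-partition : ∀ {m k} (c : Fin m → Fin k) (p : Fin m → Bool) →
  ∑[ i < k ] count (λ x → does (c x ≟ i) ∧ p x) ≡ count p
count-partition {m} {k} c p = begin
  ∑[ i < k ] count (λ x → q x i)      ≡⟨ sum-cong-≗ (λ i → count-as-sum (λ x → q x i)) ⟩
  ∑[ i < k ] ∑[ x < m ] ⟦ q x i ⟧     ≡⟨ ∑-comm (λ i x → ⟦ q x i ⟧) ⟩
  ∑[ x < m ] ∑[ i < k ] ⟦ q x i ⟧     ≡⟨ sum-cong-≗ (λ x → count-as-sum (q x)) ⟨
  ∑[ x < m ] count (q x)              ≡⟨ sum-cong-≗ (λ x → count-fibre (c x) (p x)) ⟩
  ∑[ x < m ] ⟦ p x ⟧                  ≡⟨ count-as-sum p ⟨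
  count p                             ∎
  where
  open ≡-Reasoning
  q : Fin m → Fin k → Bool
  q x i = does (c x ≟ i) ∧ p x

maxOver-lub : ∀ {n} {f : Fin n → ℕ} {B} → (∀ i → f i ≤ B) → maxOver f ≤ B
maxOver-lub {zero}  f≤B = z≤n
maxOver-lub {suc n} f≤B = ⊔-lub (f≤B zero) (maxOver-lub (f≤B ∘ suc))

term≤maxOver : ∀ {n} (f : Fin n → ℕ) i → f i ≤ maxOver f
term≤maxOver f zero    = m≤m⊔n (f zero) _
term≤maxOver f (suc i) = ≤-trans (term≤maxOver (f ∘ suc) i) (m≤n⊔m (f zero) _)

record ImageFactorisation {m k} (c : Fin m → Fin k) : Set where
  field
    size            : ℕ
    size≤           : size ≤ k
    onto            : Fin m → Fin size
    onto-surjective : ∀ j → ∃ λ x → onto x ≡ j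
    embed           : Fin size → Fin k
    embed-injective : ∀ {i j} → embed i ≡ embed j → i ≡ j
    factorises      : ∀ x → embed (onto x) ≡ c x

  does-onto≟ : ∀ x j → does (onto x ≟ j) ≡ does (c x ≟ embed j)
  does-onto≟ x j = does-⇔
    (mk⇔ (λ onto≡j → trans (sym (factorises x)) (cong embed onto≡j))
         (λ c≡embed → embed-injective (trans (factorises x) c≡embed)))
    (onto x ≟ j) (c x ≟ embed j)

surjectiveFactorisation : ∀ {m k} (c : Fin m → Fin k) → (∀ j → ∃ λ x → c x ≡ j) →
  ImageFactorisation c
surjectiveFactorisation {k = k} c surj = record
  { size = k ; size≤ = ≤-refl ; onto = c ; onto-surjective = surj
  ; embed = id ; embed-injective = id ; factorises = λ _ → refl }

imageFactorisation : ∀ {m k} (c : Fin m → Fin k) → ImageFactorisation c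
imageFactorisation {k = zero} c = surjectiveFactorisation c λ ()
imageFactorisation {k = suc k} c with all? (λ j → any? (λ x → c x ≟ j))
... | yes surj = surjectiveFactorisation c surj
... | no ¬surj with ¬∀⟶∃¬ _ _ (λ j → any? (λ x → c x ≟ j)) ¬surj
...   | i , missed = record
  { size = size ; size≤ = m≤n⇒m≤1+n size≤ ; onto = onto ; onto-surjective = onto-surjective
  ; embed = punchIn i ∘ embed
  ; embed-injective = λ {j} {j′} eq → embed-injective (punchIn-injective i (embed j) (embed j′) eq)
  ; factorises = λ x → trans (cong (punchIn i) (factorises x)) (punchIn-punchOut _) }
  where
  open ImageFactorisation (imageFactorisation (λ x → punchOut (λ i≡cx → missed (x , sym i≡cx))))

Decomposition : ∀ {m n} (E : BipGraph m n) (a k : ℕ) → Set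
Decomposition {m} E a k = Σ (Fin k → Subgraph E) λ F →
  (∀ (i j : Fin k) x y → edge (F i) x y ≡ true → edge (F j) x y ≡ true → i ≡ j)
  × (∀ x y → E x y ≡ true → ∃ λ i → edge (F i) x y ≡ true)
  × (∀ (i : Fin k) → Δ (F i) ≡ a)
  × (∀ (x : Fin m) → ∃ λ i → inX (F i) x ≡ true × (∀ j → inX (F j) x ≡ true → j ≡ i))

module _ {m n : ℕ} (E : BipGraph m n) where

  colourDegree : ∀ {k} → (Fin m → Fin k) → Fin n → Fin k → ℕ
  colourDegree c y i = count (λ x → does (c x ≟ i) ∧ E x y)

  ClassDegreesAtMost : ∀ {k} → ℕ → (Fin m → Fin k) → Set
  ClassDegreesAtMost a c = ∀ y i → colourDegree c y i ≤ a

  colourDegree-sum : ∀ {k} (c : Fin m → Fin k) y → ∑[ i < k ] colourDegree c y i ≡ degY E y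
  colourDegree-sum c y = count-partition c (λ x → E x y)

  ClassDegreesAtMost-onto : ∀ {k a} {c : Fin m → Fin k} (f : ImageFactorisation c) →
    ClassDegreesAtMost a c → ClassDegreesAtMost a (ImageFactorisation.onto f)
  ClassDegreesAtMost-onto f bounded y j =
    subst (_≤ _) (count-cong (λ x → cong (_∧ E x y) (sym (does-onto≟ x j)))) (bounded y (embed j))
    where open ImageFactorisation f

  colourClass : ∀ {k} → (Fin m → Fin k) → Fin k → Subgraph E
  colourClass c i = record
    { inX    = λ x → does (c x ≟ i)
    ; inY    = λ _ → true
    ; edge   = λ x y → does (c x ≟ i) ∧ E x y
    ; edge⊆E = λ x y → proj₂ ∘ ∧-≡-true (does (c x ≟ i))
    ; edge⊆V = λ x y e → proj₁ (∧-≡-true (does (c x ≟ i)) e) , refl }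

  edge-colourClass : ∀ {k} (c : Fin m → Fin k) {i} x y →
    edge (colourClass c i) x y ≡ true → c x ≡ i
  edge-colourClass c x y e = ≟-true⇒≡ {i = c x} (proj₁ (∧-≡-true _ e))

  degX-colourClass≤ : ∀ {k} (c : Fin m → Fin k) i x → degX (edge (colourClass c i)) x ≤ degX E x
  degX-colourClass≤ c i x with does (c x ≟ i)
  ... | true  = ≤-refl
  ... | false = subst (_≤ degX E x) (sym (count-false {n})) z≤n

  degX-ownClass : ∀ {k} (c : Fin m → Fin k) x → degX (edge (colourClass c (c x))) x ≡ degX E x
  degX-ownClass c x = cong (λ b → count (λ y → b ∧ E x y)) (≟-refl (c x))

  colourClassDecomposition : ∀ {a k} (c : Fin m → Fin k) → (∀ x → degX E x ≡ a) →
    (∀ i → ∃ λ x → c x ≡ i) → ClassDegreesAtMost a c → Decomposition E a k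
  colourClassDecomposition {a} c regX surj bounded = colourClass c , disjoint , covered , Δ≡a , uniqueClass
    where
    disjoint : ∀ i j x y →
      edge (colourClass c i) x y ≡ true → edge (colourClass c j) x y ≡ true → i ≡ j
    disjoint i j x y inI inJ = trans (sym (edge-colourClass c x y inI)) (edge-colourClass c x y inJ)

    covered : ∀ x y → E x y ≡ true → ∃ λ i → edge (colourClass c i) x y ≡ true
    covered x y e = c x , cong₂ _∧_ (≟-refl (c x)) e

    Δ≡a : ∀ i → Δ (colourClass c i) ≡ a
    Δ≡a i with surj i
    ... | x , refl = ≤-antisym
      (⊔-lub (maxOver-lub λ x′ → ≤-trans (degX-colourClass≤ c i x′) (≤-reflexive (regX x′)))
             (maxOver-lub λ y → bounded y i))
      (begin
        a                                          ≡⟨ regX x ⟨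
        degX E x                                   ≡⟨ degX-ownClass c x ⟨
        degX (edge (colourClass c (c x))) x        ≤⟨ term≤maxOver _ x ⟩
        maxOver (degX (edge (colourClass c (c x)))) ≤⟨ m≤m⊔n _ _ ⟩
        Δ (colourClass c (c x))                    ∎)
      where open ≤-Reasoning

    uniqueClass : ∀ x → ∃ λ i →
      inX (colourClass c i) x ≡ true × (∀ j → inX (colourClass c j) x ≡ true → j ≡ i)
    uniqueClass x = c x , ≟-refl (c x) , λ j inJ → sym (≟-true⇒≡ {i = c x} inJ)

-- N is the neighbourhood of a new vertex about to be added to X.
freeColour : ∀ {m n a b} (E : BipGraph m n) (N : Fin n → Bool) →
  1 ≤ count N → count N ≤ a → (∀ y → N y ≡ true → suc (degY E y) ≤ b) →
  (c : Fin m → Fin b) → ∃ λ i → ∀ y → N y ≡ true → colourDegree E c y i < a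
freeColour {m} {n} {a} {b} E N N≢∅ |N|≤a room c
  with any? (λ i → all? (λ y → ⟦ N y ⟧ * colourDegree E c y i <? a))
... | yes (i , free) = i , λ y Ny →
  subst (_< a) (*-identityˡ _) (subst (λ t → ⟦ t ⟧ * colourDegree E c y i < a) Ny (free y))
... | no noneFree = ⊥-elim (<-irrefl refl (begin-strict
  b * a                                        ≤⟨ *≤∑∑-witnessed (λ i y → ⟦ N y ⟧ * d y i) blocked ⟩
  ∑[ i < b ] ∑[ y < n ] (⟦ N y ⟧ * d y i)      ≡⟨ ∑-comm (λ i y → ⟦ N y ⟧ * d y i) ⟩
  ∑[ y < n ] ∑[ i < b ] (⟦ N y ⟧ * d y i)      ≡⟨ sum-cong-≗ (λ y → *-distribˡ-sum ⟦ N y ⟧ (d y)) ⟨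
  ∑[ y < n ] (⟦ N y ⟧ * ∑[ i < b ] d y i)      ≡⟨ sum-cong-≗ (λ y → cong (⟦ N y ⟧ *_) (colourDegree-sum E c y)) ⟩
  ∑[ y < n ] (⟦ N y ⟧ * degY E y)              <⟨ m<n+m _ N≢∅ ⟩
  count N + ∑[ y < n ] (⟦ N y ⟧ * degY E y)    ≡⟨ cong (_+ ∑[ y < n ] (⟦ N y ⟧ * degY E y)) (count-as-sum N) ⟩
  ∑[ y < n ] ⟦ N y ⟧ + ∑[ y < n ] (⟦ N y ⟧ * degY E y)
                                               ≡⟨ ∑-distrib-+ (λ y → ⟦ N y ⟧) (λ y → ⟦ N y ⟧ * degY E y) ⟨
  ∑[ y < n ] (⟦ N y ⟧ + ⟦ N y ⟧ * degY E y)    ≡⟨ sum-cong-≗ (λ y → *-suc ⟦ N y ⟧ (degY E y)) ⟨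
  ∑[ y < n ] (⟦ N y ⟧ * suc (degY E y))        ≤⟨ ∑-mono-≤ (λ y → ⟦⟧*-monoʳ-≤ (N y) (room y)) ⟩
  ∑[ y < n ] (⟦ N y ⟧ * b)                     ≡⟨ *-distribʳ-sum b (λ y → ⟦ N y ⟧) ⟨
  (∑[ y < n ] ⟦ N y ⟧) * b                     ≡⟨ cong (_* b) (count-as-sum N) ⟨
  count N * b                                  ≤⟨ *-monoˡ-≤ b |N|≤a ⟩
  a * b                                        ≡⟨ *-comm a b ⟩
  b * a                                        ∎))
  where
  open ≤-Reasoning
  d : Fin n → Fin b → ℕ
  d = colourDegree E c
  blocked : ∀ i → ∃ λ y → a ≤ ⟦ N y ⟧ * d y i
  blocked i with ¬∀⟶∃¬ n _ (λ y → ⟦ N y ⟧ * d y i <? a) (λ free → noneFree (i , free))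
  ... | y , ¬lt = y , ≮⇒≥ ¬lt

boundedColouring : ∀ {m n a b} (E : BipGraph m n) →
  (∀ x → 1 ≤ degX E x) → (∀ x → degX E x ≤ a) → (∀ y → degY E y ≤ b) →
  Σ (Fin m → Fin b) (ClassDegreesAtMost E a)
boundedColouring {zero} E _ _ _ = (λ ()) , λ _ _ → z≤n
boundedColouring {suc m} {a = a} {b} E deg≥1 deg≤a degY≤b
  with boundedColouring (E ∘ suc) (deg≥1 ∘ suc) (deg≤a ∘ suc) (λ y → ≤-trans (m≤n+m _ _) (degY≤b y))
... | c , bounded
  -- degY E y unfolds to ⟦ E zero y ⟧ + degY (E ∘ suc) y.
  with freeColour (E ∘ suc) (E zero) (deg≥1 zero) (deg≤a zero)
         (λ y e → subst (λ t → ⟦ t ⟧ + degY (E ∘ suc) y ≤ b) e (degY≤b y)) c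
... | i₀ , free = i₀ ∷ c , extended
  where
  extended : ClassDegreesAtMost E a (i₀ ∷ c)
  extended y j with i₀ ≟ j | E zero y in e
  ... | yes refl | true  = free y e
  ... | yes refl | false = bounded y j
  ... | no _     | _     = bounded y j

lemma2p2 : ∀ {m n : ℕ} (E : BipGraph m n) (a b : ℕ) → 1 ≤ a → Biregular E a b →
    Σ ℕ λ k → k ≤ b × Σ (Fin k → Subgraph E) λ F →
      -- edge-disjoint
      (∀ (i j : Fin k) x y → edge (F i) x y ≡ true → edge (F j) x y ≡ true → i ≡ j)
      -- edge sets cover E
      × (∀ x y → E x y ≡ true → ∃ λ i → edge (F i) x y ≡ true)
      -- Δ(F_i) = a
      × (∀ (i : Fin k) → Δ (F i) ≡ a)
      -- every vertex of X lies in precisely one F_i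
      × (∀ (x : Fin m) → ∃ λ i → inX (F i) x ≡ true × (∀ j → inX (F j) x ≡ true → j ≡ i))
lemma2p2 E a b 1≤a (regX , regY)
  with boundedColouring E (λ x → subst (1 ≤_) (sym (regX x)) 1≤a) (≤-reflexive ∘ regX) (≤-reflexive ∘ regY)
... | c , bounded =
  size , size≤ , colourClassDecomposition E onto regX onto-surjective (ClassDegreesAtMost-onto E factorisation bounded)
  where
  factorisation : ImageFactorisation c
  factorisation = imageFactorisation c
  open ImageFactorisation factorisation
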